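{- Let $G=(V,E)$ be a finite simple graph and let $A,B\subseteq V$ be two disjoint vertex subsets. Then \[ \Delta(G,A,B) \;=\; -\sum_{\substack{W\subseteq A\\ W\text{ independent in }G}} \Delta\bigl(G_{ -A},\,N_G(W),\,B\bigr). \]
   Context: For a finite simple graph $H$, $\sigma(H)$ denotes the number of independent vertex sets of $H$ (subsets of vertices no two of which are adjacent), including the empty set; the graph with no vertices has $\sigma=1$. For a vertex subset $X$, $H_{ -X}$ is the graph obtained from $H$ by deleting all vertices of $X$ (that lie in $H$) together with their incident edges; $H_{ -X-Y}$ means $H_{ -(X\cup Y)}$. $N_H(W)$ denotes the open neighborhood of $W$, i.e. the set of all vertices adjacent to some vertex of $W$ (so $N_H(\emptyset)=\emptyset$). For a graph $H$ and vertex subsets $A,B$ (deleting only those vertices actually present in $H$), define $\Delta(H,A,B)=\sigma(H_{ -A})\cdot\sigma(H_{ -B})-\sigma(H)\cdot\sigma(H_{ -A-B})$. -}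

module Defs where

open import Data.Bool using (Bool; true; false; _∧_; _∨_; not; T)
open import Data.Nat using (ℕ; zero; suc)
open import Data.Fin using (Fin)
open import Data.Fin.Subset using (Subset; _─_; _∪_; _⊆_; Empty; _∩_; inside; outside)
open import Data.Vec using (Vec; []; _∷_; lookup; tabulate)
open import Data.List using (List; []; _∷_; map; _++_; filter; length; allFin)
open import Data.Bool.ListAction using (all; any)
open import Data.Integer using (ℤ; +_; _*_; _-_; -_)
open import Relation.Binary.PropositionalEquality using (_≡_)
open import Relation.Nullary.Decidable using (Dec)
import Data.Bool as Bool

record Graph (n : ℕ) : Set where
  field
    adj     : Fin n → Fin n → Bool
    adj-sym : ∀ i j → adj i j ≡ adj j i
    irrefl  : ∀ i → adj i i ≡ false
open Graph public

allSubsets : (n : ℕ) → List (Subset n)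
allSubsets zero    = [] ∷ []
allSubsets (suc n) = map (outside ∷_) (allSubsets n) ++ map (inside ∷_) (allSubsets n)

_∈ᵇ_ : {n : ℕ} → Fin n → Subset n → Bool
i ∈ᵇ W = lookup W i

subsetᵇ : {n : ℕ} → Subset n → Subset n → Bool
subsetᵇ {n} W S = all (λ i → not (i ∈ᵇ W) ∨ (i ∈ᵇ S)) (allFin n)

independentᵇ : {n : ℕ} → Graph n → Subset n → Bool
independentᵇ {n} G W =
  all (λ i → all (λ j → not ((i ∈ᵇ W) ∧ (j ∈ᵇ W) ∧ adj G i j)) (allFin n)) (allFin n)

-- A "graph" H in the sense of the paper is an induced subgraph G[S] of the
-- ambient graph G, given by its vertex set S.  Deleting X from G[S] gives G[S ─ X].

σ : {n : ℕ} → Graph n → Subset n → ℕ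
σ {n} G S = length (filter (λ W → Bool.T? (subsetᵇ W S ∧ independentᵇ G W)) (allSubsets n))

Δ : {n : ℕ} → Graph n → Subset n → Subset n → Subset n → ℤ
Δ G S A B =
  (+ σ G (S ─ A)) * (+ σ G (S ─ B)) - (+ σ G S) * (+ σ G (S ─ (A ∪ B)))

N : {n : ℕ} → Graph n → Subset n → Subset n
N {n} G W = tabulate (λ v → any (λ w → (w ∈ᵇ W) ∧ adj G w v) (allFin n))

V : {n : ℕ} → Subset n
V = Data.Fin.Subset.⊤

sumℤ : List ℤ → ℤ
sumℤ []       = + 0
sumℤ (x ∷ xs) = x Data.Integer.+ sumℤ xs

indepSubsetsOf : {n : ℕ} → Graph n → Subset n → List (Subset n)
indepSubsetsOf {n} G A =
  filter (λ W → Bool.T? (subsetᵇ W A ∧ independentᵇ G W)) (allSubsets n)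

-- Split an independent set X of G[S] as X ∩ A (an independent subset W of A)
-- and X ─ A (an independent set of G[(S ─ A) ─ N(W)]).  Counting both sides
-- gives σ(G[S]) = Σ_W σ(G[(S ─ A) ─ N(W)]) whenever A ⊆ S.  Applied to S = V
-- and to S = V ─ B (which contains A because A and B are disjoint), both
-- factors of Δ(G, A, B) involving A become sums over the same W, and the
-- identity is then linear algebra.
module Submission where

open import Defs
open import Data.Bool using (Bool; true; false; _∧_; _∨_; not; T)
open import Data.Bool.Properties using (T?; T-∧; T-≡)
open import Data.Bool.ListAction using (all; any)
open import Data.Empty using (⊥-elim)
open import Data.Fin using (Fin)
open import Data.Fin.Subset using (Subset; Empty; _∩_; _∪_; _─_; _∈_; _∉_; _⊆_; ∁; inside; outside)
open import Data.Fin.Subset.Properties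
  using (_∈?_; ∈⊤; drop-∷-⊆; x∈p∩q⁺; p∩q⊆p; p∩q⊆q; x∈p∧x∉q⇒x∈p─q; p─q⊆p; x∉p⇒x∈∁p;
         p─q─r≡p─q∪r; p─q─r≡p─r─q; ∪-comm)
open import Data.Integer using (ℤ; +_; _-_; -_)
import Data.Integer as ℤ
open import Data.Integer.Properties using (pos-+)
open import Data.Integer.Tactic.RingSolver using (solve-∀)
open import Data.List using (List; []; _∷_; _++_; map; filter; length; allFin)
open import Data.List.Membership.Propositional using (lose)
open import Data.List.Membership.Propositional.Properties using (∈-allFin)
open import Data.List.Properties using (map-++; map-cong; map-∘)
import Data.List.Relation.Unary.All as All
open import Data.List.Relation.Unary.All.Properties using (all⁺; all⁻)
open import Data.List.Relation.Unary.Any using (satisfied)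
open import Data.List.Relation.Unary.Any.Properties using (any⁺; any⁻)
open import Data.Nat using (ℕ; suc; _+_; _*_; _≟_)
open import Data.Nat.ListAction using (sum)
open import Data.Nat.ListAction.Properties using (sum-++)
open import Data.Nat.Properties using (+-identityʳ; *-zeroʳ; *-distribˡ-+; +-commutativeSemigroup)
open import Algebra.Properties.CommutativeSemigroup +-commutativeSemigroup using (interchange)
open import Data.Product using (∃; _×_; _,_)
open import Data.Product.Function.NonDependent.Propositional using (_×-⇔_)
open import Data.Sum using (_⊎_; inj₁; inj₂)
open import Data.Unit using (tt)
open import Data.Vec using (lookup; tabulate; []; _∷_; here; there)
open import Data.Vec.Properties using (lookup⇒[]=; []=⇒lookup; lookup∘tabulate)
open import Function using (_∘_; _⇔_; mk⇔; Equivalence; case_of_)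
open import Function.Construct.Composition using (_⇔-∘_)
import Function.Properties.Equivalence as ⇔
open import Relation.Binary.PropositionalEquality
open import Relation.Nullary using (¬_; yes; no)
open import Relation.Nullary.Decidable using (decidable-stable)

open Equivalence

private
  variable
    n : ℕ
    I : Set

T-not : ∀ {b} → T (not b) ⇔ (¬ T b)
T-not {false} = mk⇔ (λ _ ()) (λ _ → tt)
T-not {true}  = mk⇔ (λ ()) (λ ¬t → ¬t tt)

T-not-∨ : ∀ {b c} → T (not b ∨ c) ⇔ (T b → T c)
T-not-∨ {false} = mk⇔ (λ _ ()) (λ _ → tt)
T-not-∨ {true}  = mk⇔ (λ t _ → t) (λ f → f tt)

T-injective : ∀ {a b} → (T a ⇔ T b) → a ≡ b
T-injective {false} {false} _ = refl
T-injective {false} {true}  e = ⊥-elim (from e tt)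
T-injective {true}  {false} e = ⊥-elim (to e tt)
T-injective {true}  {true}  _ = refl

T-all-allFin : (p : Fin n → Bool) → T (all p (allFin n)) ⇔ (∀ i → T (p i))
T-all-allFin p = mk⇔ (λ t i → All.lookup (all⁺ p (allFin _) t) (∈-allFin i))
                     (λ h → all⁻ p {allFin _} (All.tabulate (λ {i} _ → h i)))

T-any-allFin : (p : Fin n → Bool) → T (any p (allFin n)) ⇔ ∃ (T ∘ p)
T-any-allFin p = mk⇔ (satisfied ∘ any⁻ p (allFin _))
                     (λ (i , t) → any⁺ p (lose (∈-allFin i) t))

T-lookup : ∀ {x : Fin n} {p : Subset n} → T (lookup p x) ⇔ x ∈ p
T-lookup {x = x} {p} = mk⇔ (lookup⇒[]= x p ∘ to T-≡) (from T-≡ ∘ []=⇒lookup)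

Independent : Graph n → Subset n → Set
Independent G W = ∀ {i j} → i ∈ W → j ∈ W → ¬ T (adj G i j)

IndependentIn : Graph n → Subset n → Subset n → Set
IndependentIn G S W = W ⊆ S × Independent G W

independentInᵇ : Graph n → Subset n → Subset n → Bool
independentInᵇ G S W = subsetᵇ W S ∧ independentᵇ G W

T-subsetᵇ : ∀ {W S : Subset n} → T (subsetᵇ W S) ⇔ W ⊆ S
T-subsetᵇ {W = W} {S} = mk⇔
  (λ t {i} i∈W → to T-lookup (to T-not-∨ (to all-T t i) (from T-lookup i∈W)))
  (λ W⊆S → from all-T λ i → from T-not-∨ (from T-lookup ∘ W⊆S ∘ to T-lookup))
  where
  all-T : T (subsetᵇ W S) ⇔ (∀ i → T (not (i ∈ᵇ W) ∨ (i ∈ᵇ S)))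
  all-T = T-all-allFin (λ i → not (i ∈ᵇ W) ∨ (i ∈ᵇ S))

T-independentᵇ : ∀ (G : Graph n) {W} → T (independentᵇ G W) ⇔ Independent G W
T-independentᵇ {n} G {W} = mk⇔
  (λ t {i} {j} i∈W j∈W a → to T-not (to (all-T i) (to all-all-T t i) j)
                             (from T-∧ (from T-lookup i∈W , from T-∧ (from T-lookup j∈W , a))))
  (λ ind → from all-all-T λ i → from (all-T i) λ j → from T-not λ t →
     let i∈W , t′ = to T-∧ t ; j∈W , a = to T-∧ t′
     in ind (to T-lookup i∈W) (to T-lookup j∈W) a)
  where
  nonadjacent : Fin n → Fin n → Bool
  nonadjacent i j = not ((i ∈ᵇ W) ∧ (j ∈ᵇ W) ∧ adj G i j)
  all-T : ∀ i → T (all (nonadjacent i) (allFin n)) ⇔ (∀ j → T (nonadjacent i j))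
  all-T i = T-all-allFin (nonadjacent i)
  all-all-T : T (independentᵇ G W) ⇔ (∀ i → T (all (nonadjacent i) (allFin n)))
  all-all-T = T-all-allFin (λ i → all (nonadjacent i) (allFin n))

T-independentInᵇ : ∀ (G : Graph n) {S W} → T (independentInᵇ G S W) ⇔ IndependentIn G S W
T-independentInᵇ G = (T-subsetᵇ ×-⇔ T-independentᵇ G) ⇔-∘ T-∧

∈-N : ∀ (G : Graph n) W {v} → v ∈ N G W ⇔ ∃ λ w → w ∈ W × T (adj G w v)
∈-N {n} G W {v} = mk⇔
  (λ v∈N → let w , t = to (T-any-allFin _) (subst T (lookup∘tabulate f v) (from T-lookup v∈N))
               w∈W , a = to T-∧ t
           in w , to T-lookup w∈W , a)
  (λ (w , w∈W , a) → to T-lookup (subst T (sym (lookup∘tabulate f v))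
                       (from (T-any-allFin _) (w , from T-∧ (from T-lookup w∈W , a)))))
  where
  f : Fin n → Bool
  f v = any (λ w → (w ∈ᵇ W) ∧ adj G w v) (allFin n)

x∈p─q⇒x∉q : ∀ {x : Fin n} (p q : Subset n) → x ∈ p ─ q → x ∉ q
x∈p─q⇒x∉q (_ ∷ p) (outside ∷ q) here          ()
x∈p─q⇒x∉q (_ ∷ p) (_       ∷ q) (there x∈p─q) (there x∈q) = x∈p─q⇒x∉q p q x∈p─q x∈q

x∈p∩q⊎x∈p─q : ∀ {x : Fin n} (p q : Subset n) → x ∈ p → x ∈ p ∩ q ⊎ x ∈ p ─ q
x∈p∩q⊎x∈p─q {x = x} p q x∈p with x ∈? q
... | yes x∈q = inj₁ (x∈p∩q⁺ (x∈p , x∈q))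
... | no  x∉q = inj₂ (x∈p∧x∉q⇒x∈p─q x∈p x∉q)

independent-anti-mono : ∀ (G : Graph n) {W X} → W ⊆ X → Independent G X → Independent G W
independent-anti-mono _ W⊆X ind i∈W j∈W = ind (W⊆X i∈W) (W⊆X j∈W)

independentIn-split : ∀ (G : Graph n) {A S X} → A ⊆ S →
  IndependentIn G S X ⇔
  (IndependentIn G A (X ∩ A) × IndependentIn G ((S ─ A) ─ N G (X ∩ A)) (X ─ A))
independentIn-split G {A} {S} {X} A⊆S = mk⇔ split join
  where
  split : IndependentIn G S X →
          IndependentIn G A (X ∩ A) × IndependentIn G ((S ─ A) ─ N G (X ∩ A)) (X ─ A)
  split (X⊆S , ind) =
    (p∩q⊆q X A , independent-anti-mono G (p∩q⊆p X A) ind) ,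
    (X─A⊆ , independent-anti-mono G (p─q⊆p X A) ind)
    where
    X─A⊆ : X ─ A ⊆ (S ─ A) ─ N G (X ∩ A)
    X─A⊆ x∈X─A = x∈p∧x∉q⇒x∈p─q
      (x∈p∧x∉q⇒x∈p─q (X⊆S (p─q⊆p X A x∈X─A)) (x∈p─q⇒x∉q X A x∈X─A))
      (λ x∈N → let _ , w∈X∩A , a = to (∈-N G (X ∩ A)) x∈N
               in ind (p∩q⊆p X A w∈X∩A) (p─q⊆p X A x∈X─A) a)
  join : IndependentIn G A (X ∩ A) × IndependentIn G ((S ─ A) ─ N G (X ∩ A)) (X ─ A) →
         IndependentIn G S X
  join ((_ , indW) , (J⊆ , indJ)) = X⊆S , ind
    where
    X⊆S : X ⊆ S
    X⊆S x∈X with x∈p∩q⊎x∈p─q X A x∈X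
    ... | inj₁ x∈X∩A = A⊆S (p∩q⊆q X A x∈X∩A)
    ... | inj₂ x∈X─A = p─q⊆p S A (p─q⊆p (S ─ A) (N G (X ∩ A)) (J⊆ x∈X─A))
    across : ∀ {i j} → i ∈ X ∩ A → j ∈ X ─ A → ¬ T (adj G i j)
    across i∈W j∈J a =
      x∈p─q⇒x∉q (S ─ A) (N G (X ∩ A)) (J⊆ j∈J) (from (∈-N G (X ∩ A)) (_ , i∈W , a))
    ind : Independent G X
    ind {i} {j} i∈X j∈X with x∈p∩q⊎x∈p─q X A i∈X | x∈p∩q⊎x∈p─q X A j∈X
    ... | inj₁ i∈W | inj₁ j∈W = indW i∈W j∈W
    ... | inj₂ i∈J | inj₂ j∈J = indJ i∈J j∈J
    ... | inj₁ i∈W | inj₂ j∈J = across i∈W j∈J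
    ... | inj₂ i∈J | inj₁ j∈W = across j∈W i∈J ∘ subst T (adj-sym G i j)

independentInᵇ-split : ∀ (G : Graph n) {A S} → A ⊆ S → ∀ X →
  independentInᵇ G S X ≡
  independentInᵇ G A (X ∩ A) ∧ independentInᵇ G ((S ─ A) ─ N G (X ∩ A)) (X ─ A)
independentInᵇ-split G A⊆S X = T-injective
  (⇔.trans (T-independentInᵇ G) (⇔.trans (independentIn-split G {X = X} A⊆S)
     (⇔.trans (⇔.sym (T-independentInᵇ G) ×-⇔ ⇔.sym (T-independentInᵇ G))
              (⇔.sym T-∧))))

𝟙 : Bool → ℕ
𝟙 false = 0
𝟙 true  = 1

𝟙-∧ : ∀ a b → 𝟙 (a ∧ b) ≡ 𝟙 a * 𝟙 b
𝟙-∧ false _ = refl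
𝟙-∧ true  b = sym (+-identityʳ (𝟙 b))

𝟙≢0⇒T : ∀ {b} → 𝟙 b ≢ 0 → T b
𝟙≢0⇒T {false} 𝟙b≢0 = 𝟙b≢0 refl
𝟙≢0⇒T {true}  _    = tt

length-filter-𝟙 : (p : I → Bool) (xs : List I) →
  length (filter (T? ∘ p) xs) ≡ sum (map (𝟙 ∘ p) xs)
length-filter-𝟙 p []       = refl
length-filter-𝟙 p (x ∷ xs) with p x
... | true  = cong suc (length-filter-𝟙 p xs)
... | false = length-filter-𝟙 p xs

sum-map-filter-𝟙 : (p : I → Bool) (f : I → ℕ) (xs : List I) →
  sum (map f (filter (T? ∘ p) xs)) ≡ sum (map (λ x → 𝟙 (p x) * f x) xs)
sum-map-filter-𝟙 p f []       = refl
sum-map-filter-𝟙 p f (x ∷ xs) with p x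
... | true  = cong₂ _+_ (sym (+-identityʳ (f x))) (sum-map-filter-𝟙 p f xs)
... | false = sum-map-filter-𝟙 p f xs

sum-map-+ : (f g : I → ℕ) (xs : List I) →
  sum (map (λ x → f x + g x) xs) ≡ sum (map f xs) + sum (map g xs)
sum-map-+ f g []       = refl
sum-map-+ f g (x ∷ xs) = trans (cong (λ s → f x + g x + s) (sum-map-+ f g xs))
                               (interchange (f x) (g x) (sum (map f xs)) (sum (map g xs)))

sum-map-*ˡ : (c : ℕ) (f : I → ℕ) (xs : List I) →
  sum (map (λ x → c * f x) xs) ≡ c * sum (map f xs)
sum-map-*ˡ c f []       = sym (*-zeroʳ c)
sum-map-*ˡ c f (x ∷ xs) = trans (cong (λ s → c * f x + s) (sum-map-*ˡ c f xs))
                                (sym (*-distribˡ-+ c (f x) (sum (map f xs))))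

sum-map-0 : (f : I → ℕ) (xs : List I) → (∀ x → f x ≡ 0) → sum (map f xs) ≡ 0
sum-map-0 f []       _  = refl
sum-map-0 f (x ∷ xs) f≡0 = cong₂ _+_ (f≡0 x) (sum-map-0 f xs f≡0)

∑ : (Subset n → ℕ) → ℕ
∑ {n} f = sum (map f (allSubsets n))

∑-cong : {f g : Subset n → ℕ} → (∀ X → f X ≡ g X) → ∑ f ≡ ∑ g
∑-cong {n} f≗g = cong sum (map-cong f≗g (allSubsets n))

∑-suc : (f : Subset (suc n) → ℕ) →
  ∑ f ≡ ∑ (f ∘ (outside ∷_)) + ∑ (f ∘ (inside ∷_))
∑-suc {n} f = begin
  sum (map f (map (outside ∷_) Xs ++ map (inside ∷_) Xs))
    ≡⟨ cong sum (map-++ f (map (outside ∷_) Xs) _) ⟩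
  sum (map f (map (outside ∷_) Xs) ++ map f (map (inside ∷_) Xs))
    ≡⟨ sum-++ (map f (map (outside ∷_) Xs)) _ ⟩
  sum (map f (map (outside ∷_) Xs)) + sum (map f (map (inside ∷_) Xs))
    ≡⟨ cong₂ _+_ (cong sum (map-∘ Xs)) (cong sum (map-∘ Xs)) ⟨
  ∑ (f ∘ (outside ∷_)) + ∑ (f ∘ (inside ∷_)) ∎
  where
  open ≡-Reasoning
  Xs : List (Subset n)
  Xs = allSubsets n

∑-outside : (f : Subset (suc n) → ℕ) → (∀ X → f (inside ∷ X) ≡ 0) →
  ∑ f ≡ ∑ (f ∘ (outside ∷_))
∑-outside {n} f f-inside≡0 = begin
  ∑ f                                            ≡⟨ ∑-suc f ⟩
  ∑ (f ∘ (outside ∷_)) + ∑ (f ∘ (inside ∷_))     ≡⟨ cong (λ s → ∑ (f ∘ (outside ∷_)) + s)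
                                                         (sum-map-0 _ (allSubsets n) f-inside≡0) ⟩
  ∑ (f ∘ (outside ∷_)) + 0                       ≡⟨ +-identityʳ _ ⟩
  ∑ (f ∘ (outside ∷_))                           ∎
  where open ≡-Reasoning

SupportedOn : (Subset n → Subset n → ℕ) → Subset n → Subset n → Set
SupportedOn h A B = ∀ W J → h W J ≢ 0 → W ⊆ A × J ⊆ B

supportedOn-vanishes : ∀ {h : Subset n → Subset n → ℕ} {A B} → SupportedOn h A B →
  ∀ {W J} → ¬ (W ⊆ A × J ⊆ B) → h W J ≡ 0
supportedOn-vanishes {h = h} supp {W} {J} outside-support =
  decidable-stable (h W J ≟ 0) (outside-support ∘ supp W J)

supportedOn-∷ : ∀ {h : Subset (suc n) → Subset (suc n) → ℕ} {a b A B} w j →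
  SupportedOn h (a ∷ A) (b ∷ B) → SupportedOn (λ W J → h (w ∷ W) (j ∷ J)) A B
supportedOn-∷ w j supp W J h≢0 =
  let W⊆ , J⊆ = supp (w ∷ W) (j ∷ J) h≢0 in drop-∷-⊆ W⊆ , drop-∷-⊆ J⊆

-- X ↦ (X ∩ A, X ─ A) is a bijection onto the pairs (W, J) with W ⊆ A and J ⊆ ∁ A.
∑-split : (A : Subset n) (h : Subset n → Subset n → ℕ) → SupportedOn h A (∁ A) →
  ∑ (λ X → h (X ∩ A) (X ─ A)) ≡ ∑ (λ W → ∑ (h W))
∑-split []            h supp = sym (+-identityʳ _)
∑-split (inside ∷ A)  h supp = begin
  ∑ (λ X → h (X ∩ (inside ∷ A)) (X ─ (inside ∷ A)))
    ≡⟨ ∑-suc (λ X → h (X ∩ (inside ∷ A)) (X ─ (inside ∷ A))) ⟩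
  ∑ (λ X → h (outside ∷ (X ∩ A)) (outside ∷ (X ─ A)))
    + ∑ (λ X → h (inside ∷ (X ∩ A)) (outside ∷ (X ─ A)))
    ≡⟨ cong₂ _+_ (∑-split A _ (supportedOn-∷ outside outside supp))
                 (∑-split A _ (supportedOn-∷ inside outside supp)) ⟩
  ∑ (λ W → ∑ (λ J → h (outside ∷ W) (outside ∷ J)))
    + ∑ (λ W → ∑ (λ J → h (inside ∷ W) (outside ∷ J)))
    ≡⟨ cong₂ _+_ (∑-cong (J-outside outside)) (∑-cong (J-outside inside)) ⟨
  ∑ (λ W → ∑ (h (outside ∷ W))) + ∑ (λ W → ∑ (h (inside ∷ W)))
    ≡⟨ ∑-suc (λ W → ∑ (h W)) ⟨
  ∑ (λ W → ∑ (h W)) ∎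
  where
  open ≡-Reasoning
  J-outside : ∀ w W → ∑ (h (w ∷ W)) ≡ ∑ (λ J → h (w ∷ W) (outside ∷ J))
  J-outside w W = ∑-outside (h (w ∷ W)) λ J →
    supportedOn-vanishes supp λ (_ , J⊆) → case J⊆ here of λ ()
∑-split (outside ∷ A) h supp = begin
  ∑ (λ X → h (X ∩ (outside ∷ A)) (X ─ (outside ∷ A)))
    ≡⟨ ∑-suc (λ X → h (X ∩ (outside ∷ A)) (X ─ (outside ∷ A))) ⟩
  ∑ (λ X → h (outside ∷ (X ∩ A)) (outside ∷ (X ─ A)))
    + ∑ (λ X → h (outside ∷ (X ∩ A)) (inside ∷ (X ─ A)))
    ≡⟨ cong₂ _+_ (∑-split A _ (supportedOn-∷ outside outside supp))
                 (∑-split A _ (supportedOn-∷ outside inside supp)) ⟩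
  ∑ (λ W → ∑ (λ J → h (outside ∷ W) (outside ∷ J)))
    + ∑ (λ W → ∑ (λ J → h (outside ∷ W) (inside ∷ J)))
    ≡⟨ sum-map-+ (λ W → ∑ (λ J → h (outside ∷ W) (outside ∷ J)))
                 (λ W → ∑ (λ J → h (outside ∷ W) (inside ∷ J))) (allSubsets _) ⟨
  ∑ (λ W → ∑ (λ J → h (outside ∷ W) (outside ∷ J)) + ∑ (λ J → h (outside ∷ W) (inside ∷ J)))
    ≡⟨ ∑-cong (λ W → ∑-suc (h (outside ∷ W))) ⟨
  ∑ (λ W → ∑ (h (outside ∷ W)))
    ≡⟨ ∑-outside (λ W → ∑ (h W)) W-outside ⟨
  ∑ (λ W → ∑ (h W)) ∎
  where
  open ≡-Reasoning
  W-outside : ∀ W → ∑ (h (inside ∷ W)) ≡ 0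
  W-outside W = sum-map-0 (h (inside ∷ W)) (allSubsets _) λ J →
    supportedOn-vanishes supp λ (W⊆ , _) → case W⊆ here of λ ()

σ-decompose : (G : Graph n) {A S : Subset n} → A ⊆ S →
  σ G S ≡ sum (map (λ W → σ G ((S ─ A) ─ N G W)) (indepSubsetsOf G A))
σ-decompose {n} G {A} {S} A⊆S = begin
  σ G S
    ≡⟨ length-filter-𝟙 (independentInᵇ G S) (allSubsets n) ⟩
  ∑ (𝟙 ∘ independentInᵇ G S)
    ≡⟨ ∑-cong (cong 𝟙 ∘ independentInᵇ-split G A⊆S) ⟩
  ∑ (λ X → pair (X ∩ A) (X ─ A))
    ≡⟨ ∑-split A pair pair-supported ⟩
  ∑ (λ W → ∑ (pair W))
    ≡⟨ ∑-cong count-rest ⟩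
  ∑ (λ W → 𝟙 (independentInᵇ G A W) * σ G (rest W))
    ≡⟨ sum-map-filter-𝟙 (independentInᵇ G A) (σ G ∘ rest) (allSubsets n) ⟨
  sum (map (σ G ∘ rest) (indepSubsetsOf G A)) ∎
  where
  open ≡-Reasoning
  rest : Subset n → Subset n
  rest W = (S ─ A) ─ N G W
  pair : Subset n → Subset n → ℕ
  pair W J = 𝟙 (independentInᵇ G A W ∧ independentInᵇ G (rest W) J)
  pair-supported : SupportedOn pair A (∁ A)
  pair-supported W J pair≢0 =
    let indW , indJ = to T-∧ (𝟙≢0⇒T pair≢0)
        W⊆A , _ = to (T-independentInᵇ G) indW
        J⊆rest , _ = to (T-independentInᵇ G) indJ
    in W⊆A , λ x∈J → x∉p⇒x∈∁p (x∈p─q⇒x∉q S A (p─q⊆p (S ─ A) (N G W) (J⊆rest x∈J)))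
  count-rest : ∀ W → ∑ (pair W) ≡ 𝟙 (independentInᵇ G A W) * σ G (rest W)
  count-rest W = begin
    ∑ (pair W)
      ≡⟨ ∑-cong (λ J → 𝟙-∧ (independentInᵇ G A W) (independentInᵇ G (rest W) J)) ⟩
    ∑ (λ J → 𝟙 (independentInᵇ G A W) * 𝟙 (independentInᵇ G (rest W) J))
      ≡⟨ sum-map-*ˡ (𝟙 (independentInᵇ G A W)) (𝟙 ∘ independentInᵇ G (rest W)) (allSubsets n) ⟩
    𝟙 (independentInᵇ G A W) * ∑ (𝟙 ∘ independentInᵇ G (rest W))
      ≡⟨ cong (𝟙 (independentInᵇ G A W) *_) (length-filter-𝟙 (independentInᵇ G (rest W)) (allSubsets n)) ⟨
    𝟙 (independentInᵇ G A W) * σ G (rest W) ∎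

σ-decompose-─ : (G : Graph n) {A B S : Subset n} → A ⊆ S → Empty (A ∩ B) →
  σ G (S ─ B) ≡ sum (map (λ W → σ G ((S ─ A) ─ (N G W ∪ B))) (indepSubsetsOf G A))
σ-decompose-─ G {A} {B} {S} A⊆S A∩B=∅ =
  trans (σ-decompose G A⊆S─B) (cong sum (map-cong (cong (σ G) ∘ reorder) (indepSubsetsOf G A)))
  where
  A⊆S─B : A ⊆ S ─ B
  A⊆S─B x∈A = x∈p∧x∉q⇒x∈p─q (A⊆S x∈A) (λ x∈B → A∩B=∅ (_ , x∈p∩q⁺ (x∈A , x∈B)))
  reorder : ∀ W → ((S ─ B) ─ A) ─ N G W ≡ (S ─ A) ─ (N G W ∪ B)
  reorder W = trans (cong (_─ N G W) (p─q─r≡p─r─q S B A))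
                    (trans (p─q─r≡p─q∪r (S ─ A) B (N G W)) (cong ((S ─ A) ─_) (∪-comm B (N G W))))

sumℤ-map-bilinear : (f g : I → ℕ) (a b : ℤ) (xs : List I) →
  sumℤ (map (λ x → + f x ℤ.* a - b ℤ.* + g x) xs) ≡ + sum (map f xs) ℤ.* a - b ℤ.* + sum (map g xs)
sumℤ-map-bilinear f g a b []       = zero-bilinear a b
  where
  zero-bilinear : ∀ a b → + 0 ≡ + 0 ℤ.* a - b ℤ.* + 0
  zero-bilinear = solve-∀
sumℤ-map-bilinear f g a b (x ∷ xs) = begin
  (+ f x ℤ.* a - b ℤ.* + g x) ℤ.+ sumℤ (map (λ x → + f x ℤ.* a - b ℤ.* + g x) xs)
    ≡⟨ cong (λ s → (+ f x ℤ.* a - b ℤ.* + g x) ℤ.+ s) (sumℤ-map-bilinear f g a b xs) ⟩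
  (+ f x ℤ.* a - b ℤ.* + g x) ℤ.+ (+ sum (map f xs) ℤ.* a - b ℤ.* + sum (map g xs))
    ≡⟨ add-bilinear (+ f x) (+ sum (map f xs)) (+ g x) (+ sum (map g xs)) a b ⟩
  (+ f x ℤ.+ + sum (map f xs)) ℤ.* a - b ℤ.* (+ g x ℤ.+ + sum (map g xs))
    ≡⟨ cong₂ (λ p q → p ℤ.* a - b ℤ.* q) (pos-+ (f x) _) (pos-+ (g x) _) ⟨
  + (f x + sum (map f xs)) ℤ.* a - b ℤ.* + (g x + sum (map g xs)) ∎
  where
  open ≡-Reasoning
  add-bilinear : ∀ p q r s a b →
    (p ℤ.* a - b ℤ.* r) ℤ.+ (q ℤ.* a - b ℤ.* s) ≡ (p ℤ.+ q) ℤ.* a - b ℤ.* (r ℤ.+ s)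
  add-bilinear = solve-∀

lemma2p2 : {n : ℕ} (G : Graph n) (A B : Subset n) → Empty (A ∩ B) →
    Δ G V A B ≡ - sumℤ (map (λ W → Δ G (V ─ A) (N G W) B) (indepSubsetsOf G A))
lemma2p2 {n} G A B A∩B=∅ = begin
  σᴬ ℤ.* + σ G (V ─ B) - + σ G V ℤ.* + σ G (V ─ (A ∪ B))
    ≡⟨ cong₂ (λ s t → σᴬ ℤ.* + s - + t ℤ.* + σ G (V ─ (A ∪ B))) σ[V─B] σ[V] ⟩
  σᴬ ℤ.* sum₂ - sum₁ ℤ.* + σ G (V ─ (A ∪ B))
    ≡⟨ cong (λ Y → σᴬ ℤ.* sum₂ - sum₁ ℤ.* + σ G Y) (p─q─r≡p─q∪r V A B) ⟨
  σᴬ ℤ.* sum₂ - sum₁ ℤ.* σᴬᴮ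
    ≡⟨ swap-difference σᴬ sum₂ sum₁ σᴬᴮ ⟩
  - (sum₁ ℤ.* σᴬᴮ - σᴬ ℤ.* sum₂)
    ≡⟨ cong -_ (sumℤ-map-bilinear s₁ s₂ σᴬᴮ σᴬ L) ⟨
  - sumℤ (map (λ W → Δ G (V ─ A) (N G W) B) L) ∎
  where
  open ≡-Reasoning
  L : List (Subset n)
  L = indepSubsetsOf G A
  s₁ s₂ : Subset n → ℕ
  s₁ W = σ G ((V ─ A) ─ N G W)
  s₂ W = σ G ((V ─ A) ─ (N G W ∪ B))
  σᴬ σᴬᴮ sum₁ sum₂ : ℤ
  σᴬ   = + σ G (V ─ A)
  σᴬᴮ  = + σ G ((V ─ A) ─ B)
  sum₁ = + sum (map s₁ L)
  sum₂ = + sum (map s₂ L)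
  σ[V] : σ G V ≡ sum (map s₁ L)
  σ[V] = σ-decompose G (λ _ → ∈⊤)
  σ[V─B] : σ G (V ─ B) ≡ sum (map s₂ L)
  σ[V─B] = σ-decompose-─ G (λ _ → ∈⊤) A∩B=∅
  swap-difference : ∀ p q r s → p ℤ.* q - r ℤ.* s ≡ - (r ℤ.* s - p ℤ.* q)
  swap-difference = solve-∀
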